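{- Let $t$ be a closed System T term of type $(\iota\Rightarrow\iota)\Rightarrow\iota$. Then for every $\alpha:\mathbb{N}\to\mathbb{N}$, the number $m:=[\![\mathsf{modulus}^T\,(\mathsf{dialogueTree}_\iota(t))]\!]\,\alpha$ is a modulus of continuity of $[\![t]\!]:(\mathbb{N}\to\mathbb{N})\to\mathbb{N}$ at $\alpha$, i.e. for all $\beta:\mathbb{N}\to\mathbb{N}$, if $\alpha(i)=\beta(i)$ for all $i<m$, then $[\![t]\!]\,\alpha=[\![t]\!]\,\beta$.
   Context: Metatheory: constructive Martin-Löf type theory without function extensionality; $\mathsf{Natrec}\,f\,x\,0=x$, $\mathsf{Natrec}\,f\,x\,(n+1)=f\,n\,(\mathsf{Natrec}\,f\,x\,n)$. System T: types generated by base type $\iota$ and $\sigma\Rightarrow\tau$; terms: variables, $\mathsf{zero}:\iota$, $\mathsf{succ}\,t$, $\mathsf{rec}_\sigma\,t\,p\,q:\sigma$ ($t:\iota\Rightarrow\sigma\Rightarrow\sigma$, $p:\sigma$, $q:\iota$), $\lambda$-abstraction and application. Set interpretation: $[\![\iota]\!]=\mathbb{N}$, $[\![\sigma\Rightarrow\tau]\!]=[\![\sigma]\!]\to[\![\tau]\!]$, $[\![\mathsf{zero}]\!]=0$, $[\![\mathsf{succ}\,t]\!]\gamma=[\![t]\!]\gamma+1$, $[\![\mathsf{rec}_\sigma t_1t_2t_3]\!]\gamma=\mathsf{Natrec}([\![t_1]\!]\gamma)([\![t_2]\!]\gamma)([\![t_3]\!]\gamma)$, standard clauses for variables, $\lambda$,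 application; $[\![t]\!]$ for closed $t$. Internal dialogue trees: for System T types $A,\sigma$, $\mathsf{ChD}_A(\sigma):=(\sigma\Rightarrow A)\Rightarrow((\iota\Rightarrow A)\Rightarrow\iota\Rightarrow A)\Rightarrow A$; $\eta_A:=\lambda z\,e\,b.\,e\,z$; $\beta_A:=\lambda\varphi\,x\,e\,b.\,b\,(\lambda y.\varphi\,y\,e\,b)\,x$; $K_A:=\lambda f\,d\,e'\,b'.\,d\,(\lambda x.f\,x\,e'\,b')\,b'$; $\mathsf{map}_A:=\lambda f.K_A(\lambda x.\eta_A(f\,x))$. Type translation $\lceil\iota\rceil_A=\mathsf{ChD}_A(\iota)$, $\lceil\sigma\Rightarrow\tau\rceil_A=\lceil\sigma\rceil_A\Rightarrow\lceil\tau\rceil_A$. $\mathsf{ext}^T_{\iota,A}:=K_A$, $\mathsf{ext}^T_{\sigma_1\Rightarrow\sigma_2,A}:=\lambda f\,d\,s.\mathsf{ext}^T_{\sigma_2,A}(\lambda x.f\,x\,s)\,d$. Term translation: $\lceil x\rceil_A=x$, $\lceil\mathsf{zero}\rceil_A=\eta_A\,\mathsf{zero}$, $\lceil\mathsf{succ}\,t\rceil_A=\mathsf{map}_A(\lambda n.\mathsf{succ}\,n)\lceil t\rceil_A$, $\lceil\mathsf{rec}_\sigma t_1t_2t_3\rceil_A=\mathsf{ext}^T_{\sigma,A}(\lambda n.\mathsf{rec}_{\lceil\sigma\rceil_A}(\lambda x.\lceil t_1\rceil_A(\eta_A x))\lceil t_2\rceil_A\,n)\lceil t_3\rceil_A$,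 $\lambda$ and application translated homomorphically. $\mathsf{generic}_A:=K_A(\lambda i.\beta_A\,\eta_A\,i)$; $\mathsf{dialogueTree}_A(t):=\lceil t\rceil_A\,\mathsf{generic}_A$ for closed $t:(\iota\Rightarrow\iota)\Rightarrow\iota$. Fix a closed System T term $\mathsf{max}^T:\iota\Rightarrow\iota\Rightarrow\iota$ with $[\![\mathsf{max}^T]\!]\,a\,b=\max(a,b)$. $\mathsf{maxQ}^T:=\lambda d\,\alpha.\,d\,(\lambda w.\mathsf{zero})\,(\lambda g\,x.\,\mathsf{max}^T\,x\,(g\,(\alpha\,x)))$ of type $\mathsf{ChD}_\iota(\iota)\Rightarrow(\iota\Rightarrow\iota)\Rightarrow\iota$, and $\mathsf{modulus}^T:=\lambda d\,\alpha.\,\mathsf{succ}(\mathsf{maxQ}^T\,d\,\alpha)$. -}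

module Defs where

open import Data.Nat using (ℕ; zero; suc)
open import Data.Unit using (⊤; tt)
open import Data.Product using (_×_; _,_)

Natrec : {X : Set} → (ℕ → X → X) → X → ℕ → X
Natrec f x zero    = x
Natrec f x (suc n) = f n (Natrec f x n)

infixr 5 _⇒_
data Ty : Set where
  ι   : Ty
  _⇒_ : Ty → Ty → Ty

infixl 4 _▹_
data Ctx : Set where
  ε   : Ctx
  _▹_ : Ctx → Ty → Ctx

infix 3 _∋_
data _∋_ : Ctx → Ty → Set where
  vz : ∀ {Γ σ} → Γ ▹ σ ∋ σ
  vs : ∀ {Γ σ τ} → Γ ∋ σ → Γ ▹ τ ∋ σ

infixl 6 _·_
data Tm (Γ : Ctx) : Ty → Set where
  var  : ∀ {σ} → Γ ∋ σ → Tm Γ σ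
  Zero : Tm Γ ι
  Succ : Tm Γ ι → Tm Γ ι
  Rec  : ∀ {σ} → Tm Γ (ι ⇒ σ ⇒ σ) → Tm Γ σ → Tm Γ ι → Tm Γ σ
  Lam  : ∀ {σ τ} → Tm (Γ ▹ σ) τ → Tm Γ (σ ⇒ τ)
  _·_  : ∀ {σ τ} → Tm Γ (σ ⇒ τ) → Tm Γ σ → Tm Γ τ

Ren : Ctx → Ctx → Set
Ren Γ Δ = ∀ {σ} → Γ ∋ σ → Δ ∋ σ

liftR : ∀ {Γ Δ τ} → Ren Γ Δ → Ren (Γ ▹ τ) (Δ ▹ τ)
liftR ρ vz     = vz
liftR ρ (vs x) = vs (ρ x)

ren : ∀ {Γ Δ σ} → Ren Γ Δ → Tm Γ σ → Tm Δ σ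
ren ρ (var x)       = var (ρ x)
ren ρ Zero          = Zero
ren ρ (Succ t)      = Succ (ren ρ t)
ren ρ (Rec t p q)   = Rec (ren ρ t) (ren ρ p) (ren ρ q)
ren ρ (Lam t)       = Lam (ren (liftR ρ) t)
ren ρ (t · u)       = ren ρ t · ren ρ u

wk : ∀ {Γ σ τ} → Tm Γ σ → Tm (Γ ▹ τ) σ
wk = ren vs

closeRen : ∀ {Γ} → Ren ε Γ
closeRen ()

close : ∀ {Γ σ} → Tm ε σ → Tm Γ σ
close = ren closeRen

⟦_⟧ty : Ty → Set
⟦ ι ⟧ty     = ℕ
⟦ σ ⇒ τ ⟧ty = ⟦ σ ⟧ty → ⟦ τ ⟧ty

Env : Ctx → Set
Env ε       = ⊤
Env (Γ ▹ σ) = Env Γ × ⟦ σ ⟧ty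

lookupEnv : ∀ {Γ σ} → Γ ∋ σ → Env Γ → ⟦ σ ⟧ty
lookupEnv vz     (γ , a) = a
lookupEnv (vs x) (γ , a) = lookupEnv x γ

⟦_⟧ : ∀ {Γ σ} → Tm Γ σ → Env Γ → ⟦ σ ⟧ty
⟦ var x ⟧ γ     = lookupEnv x γ
⟦ Zero ⟧ γ      = 0
⟦ Succ t ⟧ γ    = suc (⟦ t ⟧ γ)
⟦ Rec t p q ⟧ γ = Natrec (⟦ t ⟧ γ) (⟦ p ⟧ γ) (⟦ q ⟧ γ)
⟦ Lam t ⟧ γ     = λ a → ⟦ t ⟧ (γ , a)
⟦ t · u ⟧ γ     = ⟦ t ⟧ γ (⟦ u ⟧ γ)

⟦_⟧₀ : ∀ {σ} → Tm ε σ → ⟦ σ ⟧ty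
⟦ t ⟧₀ = ⟦ t ⟧ tt

v0 : ∀ {Γ σ} → Tm (Γ ▹ σ) σ
v0 = var vz
v1 : ∀ {Γ σ τ} → Tm (Γ ▹ σ ▹ τ) σ
v1 = var (vs vz)
v2 : ∀ {Γ σ τ₁ τ₂} → Tm (Γ ▹ σ ▹ τ₁ ▹ τ₂) σ
v2 = var (vs (vs vz))
v3 : ∀ {Γ σ τ₁ τ₂ τ₃} → Tm (Γ ▹ σ ▹ τ₁ ▹ τ₂ ▹ τ₃) σ
v3 = var (vs (vs (vs vz)))
v4 : ∀ {Γ σ τ₁ τ₂ τ₃ τ₄} → Tm (Γ ▹ σ ▹ τ₁ ▹ τ₂ ▹ τ₃ ▹ τ₄) σ
v4 = var (vs (vs (vs (vs vz))))

-- internal dialogue trees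
ChD : Ty → Ty → Ty
ChD A σ = (σ ⇒ A) ⇒ ((ι ⇒ A) ⇒ ι ⇒ A) ⇒ A

-- η_A := λ z e b. e z
ηT : ∀ {Γ} (A X : Ty) → Tm Γ (X ⇒ ChD A X)
ηT A X = Lam (Lam (Lam (v1 · v2)))

-- β_A := λ φ x e b. b (λ y. φ y e b) x
βT : ∀ {Γ} (A X : Ty) → Tm Γ ((ι ⇒ ChD A X) ⇒ ι ⇒ ChD A X)
βT A X = Lam (Lam (Lam (Lam (v0 · Lam (v4 · v0 · v2 · v1) · v2))))

-- K_A := λ f d e' b'. d (λ x. f x e' b') b'
KT : ∀ {Γ} (A X Y : Ty) → Tm Γ ((X ⇒ ChD A Y) ⇒ ChD A X ⇒ ChD A Y)
KT A X Y = Lam (Lam (Lam (Lam (v2 · Lam (v4 · v0 · v2 · v1) · v0))))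

-- map_A := λ f. K_A (λ x. η_A (f x))
mapT : ∀ {Γ} (A X Y : Ty) → Tm Γ ((X ⇒ Y) ⇒ ChD A X ⇒ ChD A Y)
mapT A X Y = Lam (KT A X Y · Lam (ηT A Y · (v1 · v0)))

⌈_⌉ty : Ty → Ty → Ty
⌈ ι ⌉ty A     = ChD A ι
⌈ σ ⇒ τ ⌉ty A = ⌈ σ ⌉ty A ⇒ ⌈ τ ⌉ty A

⌈_⌉ctx : Ctx → Ty → Ctx
⌈ ε ⌉ctx A     = ε
⌈ Γ ▹ σ ⌉ctx A = ⌈ Γ ⌉ctx A ▹ ⌈ σ ⌉ty A

extT : ∀ {Γ} (σ A : Ty) → Tm Γ ((ι ⇒ ⌈ σ ⌉ty A) ⇒ ChD A ι ⇒ ⌈ σ ⌉ty A)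
extT ι A         = KT A ι ι
extT (σ₁ ⇒ σ₂) A = Lam (Lam (Lam (extT σ₂ A · Lam (v3 · v0 · v1) · v1)))

⌈_⌉var : ∀ {Γ σ} → Γ ∋ σ → (A : Ty) → ⌈ Γ ⌉ctx A ∋ ⌈ σ ⌉ty A
⌈ vz ⌉var A   = vz
⌈ vs x ⌉var A = vs (⌈ x ⌉var A)

⌈_⌉ : ∀ {Γ σ} → Tm Γ σ → (A : Ty) → Tm (⌈ Γ ⌉ctx A) (⌈ σ ⌉ty A)
⌈ var x ⌉ A = var (⌈ x ⌉var A)
⌈ Zero ⌉ A = ηT A ι · Zero
⌈ Succ t ⌉ A = mapT A ι ι · Lam (Succ v0) · ⌈ t ⌉ A
⌈ Rec {σ = σ} t₁ t₂ t₃ ⌉ A =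
  extT σ A
    · Lam (Rec (Lam (wk (wk (⌈ t₁ ⌉ A)) · (ηT A ι · v0))) (wk (⌈ t₂ ⌉ A)) v0)
    · ⌈ t₃ ⌉ A
⌈ Lam t ⌉ A = Lam (⌈ t ⌉ A)
⌈ t · u ⌉ A = ⌈ t ⌉ A · ⌈ u ⌉ A

-- generic_A := K_A (λ i. β_A η_A i)
genericT : ∀ {Γ} (A : Ty) → Tm Γ (ChD A ι ⇒ ChD A ι)
genericT A = KT A ι ι · Lam (βT A ι · ηT A ι · v0)

dialogueTree : (A : Ty) → Tm ε ((ι ⇒ ι) ⇒ ι) → Tm ε (ChD A ι)
dialogueTree A t = ⌈ t ⌉ A · genericT A

-- maxQ^T := λ d α. d (λ w. zero) (λ g x. max^T x (g (α x)))
maxQT : ∀ {Γ} → Tm ε (ι ⇒ ι ⇒ ι) → Tm Γ (ChD ι ι ⇒ (ι ⇒ ι) ⇒ ι)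
maxQT maxT = Lam (Lam (v1 · Lam Zero · Lam (Lam (close maxT · v0 · (v1 · (v2 · v0))))))

modulusT : ∀ {Γ} → Tm ε (ι ⇒ ι ⇒ ι) → Tm Γ (ChD ι ι ⇒ (ι ⇒ ι) ⇒ ι)
modulusT maxT = Lam (Lam (Succ (maxQT maxT · v1 · v0)))

{-# OPTIONS --safe #-}
-- The translation ⌈_⌉ ι interprets System T in the Church-encoded dialogue
-- trees.  A logical relation, parametrised by the sequence α, links ⟦ t ⟧ to
-- ⟦ ⌈ t ⌉ ι ⟧: at ι it asks for a dialogue tree D which the translated value
-- encodes and which evaluates along α to the standard value.  Relating the
-- generic sequence to α yields a tree D encoded by dialogueTree ι t with
-- ⟦ t ⟧₀ α ≡ dialogue D α; since the encoding determines dialogue D, one tree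
-- serves every α.  Evaluating D along α only consults α at the questions on
-- the path it follows, all of which are bounded by maxQuestion D α, and the
-- term modulusT computes exactly suc (maxQuestion D α) from the encoding of D.
module Submission where

open import Defs
open import Data.Nat using (ℕ; zero; suc; _<_; _≤_; _⊔_; s≤s)
open import Data.Nat.Properties using (m≤m⊔n; m≤n⊔m; ≤-trans)
open import Data.Unit using (tt)
open import Data.Product using (Σ; _×_; _,_; proj₁; proj₂)
open import Relation.Binary.PropositionalEquality
  using (_≡_; refl; sym; trans; cong; cong₂; subst; module ≡-Reasoning)
open ≡-Reasoning

Natrec-preserves : ∀ {X Y : Set} (P : X → Y → Set) {f : ℕ → X → X} {g : ℕ → Y → Y} {x y}
  → (∀ n a b → P a b → P (f n a) (g n b)) → P x y
  → ∀ n → P (Natrec f x n) (Natrec g y n)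
Natrec-preserves P step base zero    = base
Natrec-preserves P step base (suc n) = step n _ _ (Natrec-preserves P step base n)

ren-fusion : ∀ {Γ Δ Θ σ} {ρ : Ren Δ Θ} {ρ′ : Ren Γ Δ} {ρ″ : Ren Γ Θ}
  → (∀ {τ} (x : Γ ∋ τ) → ρ (ρ′ x) ≡ ρ″ x)
  → (u : Tm Γ σ) → ren ρ (ren ρ′ u) ≡ ren ρ″ u
ren-fusion h (var x)  = cong var (h x)
ren-fusion h Zero     = refl
ren-fusion h (Succ u) = cong Succ (ren-fusion h u)
ren-fusion h (Rec s z n) =
  trans (cong₂ (λ s′ z′ → Rec s′ z′ _) (ren-fusion h s) (ren-fusion h z))
        (cong (Rec _ _) (ren-fusion h n))
ren-fusion {ρ = ρ} {ρ′} {ρ″} h (Lam u) = cong Lam (ren-fusion liftR-fusion u)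
  where
  liftR-fusion : ∀ {τ υ} (x : _ ▹ υ ∋ τ) → liftR ρ (liftR ρ′ x) ≡ liftR ρ″ x
  liftR-fusion vz     = refl
  liftR-fusion (vs x) = cong vs (h x)
ren-fusion h (u · v)  = cong₂ _·_ (ren-fusion h u) (ren-fusion h v)

ren-id : ∀ {Γ σ} {ρ : Ren Γ Γ} → (∀ {τ} (x : Γ ∋ τ) → ρ x ≡ x) → (u : Tm Γ σ) → ren ρ u ≡ u
ren-id h (var x)  = cong var (h x)
ren-id h Zero     = refl
ren-id h (Succ u) = cong Succ (ren-id h u)
ren-id h (Rec s z n) =
  trans (cong₂ (λ s′ z′ → Rec s′ z′ _) (ren-id h s) (ren-id h z))
        (cong (Rec _ _) (ren-id h n))
ren-id {ρ = ρ} h (Lam u) = cong Lam (ren-id liftR-id u)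
  where
  liftR-id : ∀ {τ υ} (x : _ ▹ υ ∋ τ) → liftR ρ x ≡ x
  liftR-id vz     = refl
  liftR-id (vs x) = cong vs (h x)
ren-id h (u · v)  = cong₂ _·_ (ren-id h u) (ren-id h v)

ExtEq : (σ : Ty) → ⟦ σ ⟧ty → ⟦ σ ⟧ty → Set
ExtEq ι       a b = a ≡ b
ExtEq (σ ⇒ τ) f g = ∀ x y → ExtEq σ x y → ExtEq τ (f x) (g y)

⟦ren⟧ : ∀ {Γ Δ σ} (u : Tm Γ σ) (ρ : Ren Γ Δ) {γ : Env Γ} {δ : Env Δ}
  → (∀ {τ} (x : Γ ∋ τ) → ExtEq τ (lookupEnv x γ) (lookupEnv (ρ x) δ))
  → ExtEq σ (⟦ u ⟧ γ) (⟦ ren ρ u ⟧ δ)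
⟦ren⟧ (var x)              ρ h = h x
⟦ren⟧ Zero                 ρ h = refl
⟦ren⟧ (Succ u)             ρ h = cong suc (⟦ren⟧ u ρ h)
⟦ren⟧ (Rec {σ = σ} s z n) ρ {δ = δ} h rewrite ⟦ren⟧ n ρ h =
  Natrec-preserves (ExtEq σ) (λ k → ⟦ren⟧ s ρ h k k refl) (⟦ren⟧ z ρ h) (⟦ ren ρ n ⟧ δ)
⟦ren⟧ (Lam u) ρ {γ} {δ} h x y x≈y = ⟦ren⟧ u (liftR ρ) h′
  where
  h′ : ∀ {τ} (z : _ ∋ τ) → ExtEq τ (lookupEnv z (γ , x)) (lookupEnv (liftR ρ z) (δ , y))
  h′ vz     = x≈y
  h′ (vs z) = h z
⟦ren⟧ (u · v)              ρ h = ⟦ren⟧ u ρ h _ _ (⟦ren⟧ v ρ h)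

close-max : (maxT : Tm ε (ι ⇒ ι ⇒ ι)) → (∀ a b → ⟦ maxT ⟧₀ a b ≡ a ⊔ b)
  → ∀ {Γ} (γ : Env Γ) a b → ⟦ close maxT ⟧ γ a b ≡ a ⊔ b
close-max maxT max-correct γ a b =
  trans (sym (⟦ren⟧ maxT closeRen (λ ()) a a refl b b refl)) (max-correct a b)

data Tree : Set where
  leaf : ℕ → Tree
  node : (ℕ → Tree) → ℕ → Tree

_>>=_ : Tree → (ℕ → Tree) → Tree
leaf n >>= F = F n
node φ n >>= F = node (λ y → φ y >>= F) n

dialogue : Tree → (ℕ → ℕ) → ℕ
dialogue (leaf n)   α = n
dialogue (node φ n) α = dialogue (φ (α n)) α

dialogue-bind : ∀ D F α → dialogue (D >>= F) α ≡ dialogue (F (dialogue D α)) α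
dialogue-bind (leaf n)   F α = refl
dialogue-bind (node φ n) F α = dialogue-bind (φ (α n)) F α

fold : Tree → ⟦ ChD ι ι ⟧ty
fold (leaf n)   e b = e n
fold (node φ n) e b = b (λ y → fold (φ y) e b) n

Extensional : ((ℕ → ℕ) → ℕ → ℕ) → Set
Extensional b = ∀ g g′ → (∀ y → g y ≡ g′ y) → ∀ x → b g x ≡ b g′ x

fold-cong : ∀ D {e e′ b b′} → Extensional b
  → (∀ n → e n ≡ e′ n) → (∀ g x → b g x ≡ b′ g x) → fold D e b ≡ fold D e′ b′
fold-cong (leaf n)   b-ext he hb = he n
fold-cong (node φ n) b-ext he hb =
  trans (b-ext _ _ (λ y → fold-cong (φ y) b-ext he hb) n) (hb _ n)

fold-bind : ∀ D F {e b} → Extensional b → fold (D >>= F) e b ≡ fold D (λ x → fold (F x) e b) b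
fold-bind (leaf n)   F b-ext = refl
fold-bind (node φ n) F b-ext = b-ext _ _ (λ y → fold-bind (φ y) F b-ext) n

query : (ℕ → ℕ) → (ℕ → ℕ) → ℕ → ℕ
query α g x = g (α x)

query-extensional : ∀ α → Extensional (query α)
query-extensional α g g′ g≗g′ x = g≗g′ (α x)

fold-query : ∀ D α → fold D (λ n → n) (query α) ≡ dialogue D α
fold-query (leaf n)   α = refl
fold-query (node φ n) α = fold-query (φ (α n)) α

maxQuestion : Tree → (ℕ → ℕ) → ℕ
maxQuestion D α = fold D (λ _ → 0) (λ g x → x ⊔ g (α x))

dialogue-continuous : ∀ D {α β} → (∀ i → i ≤ maxQuestion D α → α i ≡ β i)
  → dialogue D α ≡ dialogue D β
dialogue-continuous (leaf n)   agree = refl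
dialogue-continuous (node φ n) {α} {β} agree = begin
  dialogue (φ (α n)) α  ≡⟨ dialogue-continuous (φ (α n))
                             (λ i i≤ → agree i (≤-trans i≤ (m≤n⊔m n _))) ⟩
  dialogue (φ (α n)) β  ≡⟨ cong (λ k → dialogue (φ k) β) (agree n (m≤m⊔n n _)) ⟩
  dialogue (φ (β n)) β  ∎

-- Agreement is required only for extensional b: without function
-- extensionality nothing more holds of translated terms, and it is what makes
-- fold D a congruence in its leaves.
record _encodes_ (d : ⟦ ChD ι ι ⟧ty) (D : Tree) : Set where
  constructor encoding
  field agrees : ∀ e b → Extensional b → d e b ≡ fold D e b
open _encodes_

encodes-dialogue : ∀ {d D} → d encodes D → ∀ α → d (λ n → n) (query α) ≡ dialogue D α
encodes-dialogue {D = D} enc α = trans (agrees enc _ _ (query-extensional α)) (fold-query D α)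

encodes-bind : ∀ {f : ℕ → ⟦ ChD ι ι ⟧ty} {F : ℕ → Tree} {d D}
  → (∀ x → f x encodes F x) → d encodes D → (λ e b → d (λ x → f x e b) b) encodes (D >>= F)
encodes-bind {f} {F} {d} {D} hf hd = encoding λ e b b-ext → begin
  d (λ x → f x e b) b               ≡⟨ agrees hd _ b b-ext ⟩
  fold D (λ x → f x e b) b          ≡⟨ fold-cong D b-ext (λ x → agrees (hf x) e b b-ext)
                                                  (λ _ _ → refl) ⟩
  fold D (λ x → fold (F x) e b) b   ≡⟨ sym (fold-bind D F b-ext) ⟩
  fold (D >>= F) e b                ∎

encodes-maxQuestion : ∀ {d D b} α → d encodes D → (∀ g x → b g x ≡ x ⊔ g (α x))
  → d (λ _ → 0) b ≡ maxQuestion D α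
encodes-maxQuestion {D = D} {b} α enc hb =
  trans (agrees enc _ b b-ext) (fold-cong D b-ext (λ _ → refl) hb)
  where
  b-ext : Extensional b
  b-ext g g′ g≗g′ x = trans (hb g x) (trans (cong (x ⊔_) (g≗g′ (α x))) (sym (hb g′ x)))

module _ (α : ℕ → ℕ) where

  R : (σ : Ty) → ⟦ σ ⟧ty → ⟦ ⌈ σ ⌉ty ι ⟧ty → Set
  R ι       n d = Σ Tree λ D → d encodes D × dialogue D α ≡ n
  R (σ ⇒ τ) f g = ∀ x y → R σ x y → R τ (f x) (g y)

  R-leaf : ∀ n → R ι n (λ e b → e n)
  R-leaf n = leaf n , encoding (λ _ _ _ → refl) , refl

  R-query : ∀ n → R ι (α n) (λ e b → b e n)
  R-query n = node leaf n , encoding (λ _ _ _ → refl) , refl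

  R-kleisli : ∀ {F : ℕ → ℕ} {f : ℕ → ⟦ ChD ι ι ⟧ty} {m d}
    → (∀ k → R ι (F k) (f k)) → R ι m d → R ι (F m) (λ e b → d (λ x → f x e b) b)
  R-kleisli hf (D , enc , refl) =
    D >>= tree , encodes-bind (λ k → proj₁ (proj₂ (hf k))) enc ,
    trans (dialogue-bind D tree α) (proj₂ (proj₂ (hf (dialogue D α))))
    where
    tree : ℕ → Tree
    tree k = proj₁ (hf k)

  R-extT : ∀ σ {Θ Δ} (ρ : Ren Θ Δ) (δ : Env Δ)
    {F : ℕ → ⟦ σ ⟧ty} {g : ℕ → ⟦ ⌈ σ ⌉ty ι ⟧ty} {m d}
    → (∀ k → R σ (F k) (g k)) → R ι m d → R σ (F m) (⟦ ren ρ (extT σ ι) ⟧ δ g d)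
  R-extT ι         ρ δ hF hm = R-kleisli hF hm
  R-extT (σ₁ ⇒ σ₂) ρ δ {F} {g} {d = d} hF hm x s r =
    R-extT σ₂ (liftR (liftR (liftR ρ))) (((δ , g) , d) , s) {λ k → F k x} {λ k → g k s}
      (λ k → hF k x s r) hm

  REnv : ∀ {Γ Δ} → Ren (⌈ Γ ⌉ctx ι) Δ → Env Γ → Env Δ → Set
  REnv {Γ} ρ γ δ = ∀ {τ} (x : Γ ∋ τ) → R τ (lookupEnv x γ) (lookupEnv (ρ (⌈ x ⌉var ι)) δ)

  REnv-extend : ∀ {Γ Δ σ} {ρ : Ren (⌈ Γ ⌉ctx ι) Δ} {γ δ x y}
    → REnv ρ γ δ → R σ x y → REnv (liftR ρ) (γ , x) (δ , y)
  REnv-extend h r vz     = r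
  REnv-extend h r (vs z) = h z

  fundamental : ∀ {Γ σ} (t : Tm Γ σ) {Δ} (ρ : Ren (⌈ Γ ⌉ctx ι) Δ) (γ : Env Γ) (δ : Env Δ)
    → REnv ρ γ δ → R σ (⟦ t ⟧ γ) (⟦ ren ρ (⌈ t ⌉ ι) ⟧ δ)
  fundamental (var x)  ρ γ δ h = h x
  fundamental Zero     ρ γ δ h = R-leaf 0
  fundamental (Succ t) ρ γ δ h = R-kleisli (λ k → R-leaf (suc k)) (fundamental t ρ γ δ h)
  fundamental (Rec {σ = σ} t₁ t₂ t₃) ρ γ δ h =
    R-extT σ ρ δ (λ k → Natrec-preserves (R σ) (step k) (base k) k) (fundamental t₃ ρ γ δ h)
    where
    base : ∀ k → R σ (⟦ t₂ ⟧ γ) (⟦ ren (liftR ρ) (wk (⌈ t₂ ⌉ ι)) ⟧ (δ , k))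
    base k = subst (λ u → R σ (⟦ t₂ ⟧ γ) (⟦ u ⟧ (δ , k)))
      (sym (ren-fusion (λ _ → refl) (⌈ t₂ ⌉ ι)))
      (fundamental t₂ (λ x → vs (ρ x)) γ (δ , k) h)
    step : ∀ k n a b → R σ a b
      → R σ (⟦ t₁ ⟧ γ n a)
            (⟦ ren (liftR (liftR ρ)) (wk (wk (⌈ t₁ ⌉ ι))) ⟧ ((δ , k) , n) (λ e b → e n) b)
    step k n = subst (λ u → R (σ ⇒ σ) (⟦ t₁ ⟧ γ n) (⟦ u ⟧ ((δ , k) , n) (λ e b → e n)))
      (sym (trans (ren-fusion (λ _ → refl) (wk (⌈ t₁ ⌉ ι)))
                  (ren-fusion (λ _ → refl) (⌈ t₁ ⌉ ι))))
      (fundamental t₁ (λ x → vs (vs (ρ x))) γ ((δ , k) , n) h n _ (R-leaf n))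
  fundamental (Lam t)  ρ γ δ h x y r = fundamental t (liftR ρ) (γ , x) (δ , y) (REnv-extend h r)
  fundamental (t · u)  ρ γ δ h = fundamental t ρ γ δ h _ _ (fundamental u ρ γ δ h)

  R-generic : R (ι ⇒ ι) α (⟦ genericT {ε} ι ⟧₀)
  R-generic n d = R-kleisli R-query

  R-dialogueTree : (t : Tm ε ((ι ⇒ ι) ⇒ ι)) → R ι (⟦ t ⟧₀ α) ⟦ dialogueTree ι t ⟧₀
  R-dialogueTree t =
    subst (λ u → R ((ι ⇒ ι) ⇒ ι) ⟦ t ⟧₀ (⟦ u ⟧ tt)) (ren-id (λ _ → refl) (⌈ t ⌉ ι))
      (fundamental t (λ x → x) tt tt (λ ()))
      α _ R-generic

dialogueTree-correct : (t : Tm ε ((ι ⇒ ι) ⇒ ι))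
  → Σ Tree λ D → ⟦ dialogueTree ι t ⟧₀ encodes D × (∀ α → dialogue D α ≡ ⟦ t ⟧₀ α)
dialogueTree-correct t =
  -- Any sequence serves to extract the tree, as the encoding fixes its dialogue.
  let (D , enc , _) = R-dialogueTree (λ _ → 0) t in
  D , enc , λ α →
    let (Dα , encα , evalα) = R-dialogueTree α t in begin
      dialogue D α                               ≡⟨ sym (encodes-dialogue enc α) ⟩
      ⟦ dialogueTree ι t ⟧₀ (λ n → n) (query α)  ≡⟨ encodes-dialogue encα α ⟩
      dialogue Dα α                              ≡⟨ evalα ⟩
      ⟦ t ⟧₀ α                                   ∎

modulusT-maxQuestion : (maxT : Tm ε (ι ⇒ ι ⇒ ι)) → (∀ a b → ⟦ maxT ⟧₀ a b ≡ a ⊔ b)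
  → ∀ {d D} → d encodes D → ∀ α → ⟦ modulusT maxT ⟧₀ d α ≡ suc (maxQuestion D α)
modulusT-maxQuestion maxT max-correct enc α =
  cong suc (encodes-maxQuestion α enc (λ g x → close-max maxT max-correct _ x (g (α x))))

theorem45 : (maxT : Tm ε (ι ⇒ ι ⇒ ι))
    → (∀ a b → ⟦ maxT ⟧₀ a b ≡ a ⊔ b)
    → (t : Tm ε ((ι ⇒ ι) ⇒ ι))
    → (α : ℕ → ℕ)
    → (β : ℕ → ℕ)
    → (∀ i → i < ⟦ modulusT maxT · dialogueTree ι t ⟧₀ α → α i ≡ β i)
    → ⟦ t ⟧₀ α ≡ ⟦ t ⟧₀ β
theorem45 maxT max-correct t α β agree =
  let (D , enc , correct) = dialogueTree-correct t
      modulus = modulusT-maxQuestion maxT max-correct enc α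
  in begin
    ⟦ t ⟧₀ α      ≡⟨ sym (correct α) ⟩
    dialogue D α  ≡⟨ dialogue-continuous D
                       (λ i i≤m → agree i (subst (i <_) (sym modulus) (s≤s i≤m))) ⟩
    dialogue D β  ≡⟨ correct β ⟩
    ⟦ t ⟧₀ β      ∎
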